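{- Let $\mathbb G=(G;\rightarrow)$ be a digraph, let $\Omega\leq\mathrm{Aut}(\mathbb G)$ be oligomorphic, let $\alpha$ be an equivalence finitising $(\mathbb G,\Omega)$, and let $H\subseteq G$ be an $\alpha$-stable $\Omega$-reductionistic set. Then $\alpha\cap(H\times H)$ finitises $(\mathbb G|_H,\Omega|_H)$.
   Context: $\Omega$ is oligomorphic if it has finitely many orbits on $G^k$ for each $k$. For a permutation group $\Upsilon$ on a set $X$ and a digraph $\mathbb X$ on $X$, let $\omega_\Upsilon$ be the equivalence whose classes are the orbits of $\Upsilon$ on $X$, and for an equivalence $\eta$ let $\mathbb X/\eta$ be the digraph on $X/\eta$ with $A\rightarrow B$ iff $a\rightarrow b$ for some $a\in A,b\in B$. An equivalence $\alpha\subseteq\omega_\Upsilon$ finitises $(\mathbb X,\Upsilon)$ if (A1) $\alpha$ is $\Upsilon$-invariant; (A2) for all $\omega_\Upsilon$-classes $O\rightarrow P$ in $\mathbb X/\omega_\Upsilon$, $\rightarrow$ on $O\times P$ induces a bijection between $O/\alpha$ and $P/\alpha$; (A3) every weakly connected component $D$ of $\mathbb X$ has $D/\alpha$ finite. A set is $\alpha$-stable if it is a union of $\alpha$-classes. $H\subsetneq G$ is $\Omega$-reductionistic if it is a class of an $\Omega$-invariant equivalence on $G$. $\mathbb G|_H$ is the induced subgraph on $H$, and $\Omega|_H:=\{f|_H: f\in\Omega, f(H)=H\}$. -}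

module Defs where

open import Data.Nat using (ℕ)
open import Data.Fin using (Fin)
open import Data.Unit using (⊤)
open import Data.Product using (Σ; ∃; ∃-syntax; _×_)
open import Relation.Nullary using (¬_)
open import Relation.Binary.PropositionalEquality using (_≡_)
open import Function.Bundles using (_⇔_)

-- To treat structures on a subset D ⊆ G (needed for G|_H and Ω|_H) without
-- subtypes, the generic notions below take a "vertex set" D : G → Set; every
-- quantification over vertices ranges over elements of D only, and a
-- permutation group on D is given by functions G → G acting on D by
-- restriction.

module _ {G : Set} where

  Univ : G → Set
  Univ _ = ⊤

  record IsAutGroup (_⇒_ : G → G → Set) (Υ : (G → G) → Set) : Set where
    field
      id∈   : Υ (λ x → x)
      ∘∈    : ∀ {f g} → Υ f → Υ g → Υ (λ x → f (g x))
      inv∈  : ∀ {f} → Υ f → Σ (G → G) λ g → Υ g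
                × (∀ x → g (f x) ≡ x) × (∀ x → f (g x) ≡ x)
      auto  : ∀ {f} → Υ f → ∀ x y → (x ⇒ y) ⇔ (f x ⇒ f y)

  -- Oligomorphic: finitely many orbits on G^k for every k, i.e. a finite
  -- list of representatives of all orbits on k-tuples.
  Oligomorphic : ((G → G) → Set) → Set
  Oligomorphic Υ = ∀ (k : ℕ) → Σ ℕ λ n → Σ (Fin n → (Fin k → G)) λ reps →
    ∀ (t : Fin k → G) → Σ (Fin n) λ i → Σ (G → G) λ f →
      Υ f × (∀ j → f (reps i j) ≡ t j)

  ω : ((G → G) → Set) → G → G → Set
  ω Υ x y = Σ (G → G) λ f → Υ f × (f x ≡ y)

  -- Class-level arrow of X/α:  [a]_α → [b]_α  (inside vertex set D).
  ClassArrow : (D : G → Set) (_⇒_ : G → G → Set) (α : G → G → Set) → G → G → Set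
  ClassArrow D _⇒_ α a b = Σ G λ a' → Σ G λ b' →
    D a' × D b' × α a a' × α b b' × (a' ⇒ b')

  data Conn (D : G → Set) (_⇒_ : G → G → Set) (x : G) : G → Set where
    here : Conn D _⇒_ x x
    fwd  : ∀ {y z} → Conn D _⇒_ x y → D z → y ⇒ z → Conn D _⇒_ x z
    bwd  : ∀ {y z} → Conn D _⇒_ x y → D z → z ⇒ y → Conn D _⇒_ x z

  record Finitises (D : G → Set) (_⇒_ : G → G → Set)
                   (Υ : (G → G) → Set) (α : G → G → Set) : Set where
    field
      α-refl  : ∀ {x} → D x → α x x
      α-sym   : ∀ {x y} → D x → D y → α x y → α y x
      α-trans : ∀ {x y z} → D x → D y → D z → α x y → α y z → α x z
      α⊆ω     : ∀ {x y} → D x → D y → α x y → ω Υ x y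
      A1 : ∀ {f} → Υ f → ∀ {x y} → D x → D y → α x y → α (f x) (f y)
      -- (A2) for ω-classes O = [o], P = [p] with o → p, the class-level
      -- relation on O/α × P/α is a bijection (total, surjective, functional,
      -- injective)
      A2-total : ∀ {o p} → D o → D p → o ⇒ p →
        ∀ {a} → D a → ω Υ o a →
        Σ G λ b → D b × ω Υ p b × ClassArrow D _⇒_ α a b
      A2-onto : ∀ {o p} → D o → D p → o ⇒ p →
        ∀ {b} → D b → ω Υ p b →
        Σ G λ a → D a × ω Υ o a × ClassArrow D _⇒_ α a b
      A2-func : ∀ {o p} → D o → D p → o ⇒ p →
        ∀ {a b b'} → D a → D b → D b' → ω Υ o a → ω Υ p b → ω Υ p b' →
        ClassArrow D _⇒_ α a b → ClassArrow D _⇒_ α a b' → α b b'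
      A2-inj : ∀ {o p} → D o → D p → o ⇒ p →
        ∀ {a a' b} → D a → D a' → D b → ω Υ o a → ω Υ o a' → ω Υ p b →
        ClassArrow D _⇒_ α a b → ClassArrow D _⇒_ α a' b → α a a'
      A3 : ∀ {x} → D x → Σ ℕ λ n → Σ (Fin n → G) λ reps →
        ∀ {y} → D y → Conn D _⇒_ x y → Σ (Fin n) λ i → α y (reps i)

  SetwiseStab : (G → Set) → (G → G) → Set
  SetwiseStab H f = (∀ x → H x → H (f x)) × (∀ y → H y → Σ G λ x → H x × (f x ≡ y))

  -- Ω|_H, represented by the functions f ∈ Ω with f(H) = H (acting on H by
  -- restriction).
  Restrict : ((G → G) → Set) → (G → Set) → (G → G) → Set
  Restrict Υ H f = Υ f × SetwiseStab H f

  _∩²_ : (G → G → Set) → (G → Set) → G → G → Set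
  (α ∩² H) x y = α x y × H x × H y

  Stable : (G → G → Set) → (G → Set) → Set
  Stable α H = ∀ {x y} → H x → α x y → H y

  Reductionistic : ((G → G) → Set) → (G → Set) → Set₁
  Reductionistic Υ H =
    (Σ G λ x → ¬ H x) ×
    (Σ (G → G → Set) λ E →
       (∀ x → E x x) × (∀ {x y} → E x y → E y x) ×
       (∀ {x y z} → E x y → E y z → E x z) ×
       (∀ {f} → Υ f → ∀ {x y} → E x y → E (f x) (f y)) ×
       (Σ G λ c → ∀ x → H x ⇔ E c x))

{-# OPTIONS --safe #-}
module Submission where

-- A class H of an Ω-invariant equivalence is mapped onto itself by every
-- f ∈ Ω that sends one point of H into H, so on H the orbits of Ω|_H are
-- exactly the orbits of Ω.  Hence every condition of "α finitises" for
-- G|_H is an instance of the same condition for G, except totality and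
-- surjectivity in (A2), which follow from Ω|_H acting by automorphisms; the
-- α-classes met in (A3) lie in H because H is α-stable.

open import Defs
open import Data.Unit using (tt)
open import Data.Product using (Σ; _×_; _,_; proj₁)
open import Relation.Binary.PropositionalEquality using (_≡_; refl; subst)
open import Function.Bundles using (_⇔_; Equivalence)

module _ {G : Set} where

  Conn-mono : {D D′ : G → Set} {_⇒_ : G → G → Set} →
    (∀ {x} → D x → D′ x) → ∀ {x y} → Conn D _⇒_ x y → Conn D′ _⇒_ x y
  Conn-mono D⊆D′ here          = here
  Conn-mono D⊆D′ (fwd xy dz e) = fwd (Conn-mono D⊆D′ xy) (D⊆D′ dz) e
  Conn-mono D⊆D′ (bwd xy dz e) = bwd (Conn-mono D⊆D′ xy) (D⊆D′ dz) e

  ClassArrow-mono : {D D′ : G → Set} {_⇒_ α β : G → G → Set} →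
    (∀ {x} → D x → D′ x) → (∀ {x y} → α x y → β x y) →
    ∀ {a b} → ClassArrow D _⇒_ α a b → ClassArrow D′ _⇒_ β a b
  ClassArrow-mono D⊆D′ α⊆β (a′ , b′ , da′ , db′ , aa′ , bb′ , e) =
    a′ , b′ , D⊆D′ da′ , D⊆D′ db′ , α⊆β aa′ , α⊆β bb′ , e

  ClassArrow-edge : {D : G → Set} {_⇒_ α : G → G → Set} →
    (∀ {x} → D x → α x x) →
    ∀ {a b} → D a → D b → a ⇒ b → ClassArrow D _⇒_ α a b
  ClassArrow-edge α-refl da db e = _ , _ , da , db , α-refl da , α-refl db , e

  ω-mono : {Υ Υ′ : (G → G) → Set} →
    (∀ {f} → Υ f → Υ′ f) → ∀ {x y} → ω Υ x y → ω Υ′ x y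
  ω-mono Υ⊆Υ′ (f , f∈ , fx≡y) = f , Υ⊆Υ′ f∈ , fx≡y

  module InvariantClass {_⇒_ : G → G → Set} {Υ : (G → G) → Set}
    (grp : IsAutGroup _⇒_ Υ) {E : G → G → Set}
    (E-sym : ∀ {x y} → E x y → E y x)
    (E-trans : ∀ {x y z} → E x y → E y z → E x z)
    (E-inv : ∀ {f} → Υ f → ∀ {x y} → E x y → E (f x) (f y))
    {H : G → Set} {c : G} (H⇔E : ∀ x → H x ⇔ E c x) where

    open IsAutGroup grp using (inv∈)

    related : ∀ {x y} → H x → H y → E x y
    related {x} {y} hx hy =
      E-trans (E-sym (Equivalence.to (H⇔E x) hx)) (Equivalence.to (H⇔E y) hy)

    H-closed : ∀ {x y} → H x → E x y → H y
    H-closed {x} {y} hx xy = Equivalence.from (H⇔E y) (E-trans (Equivalence.to (H⇔E x) hx) xy)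

    SetwiseStab-class : ∀ {f x} → Υ f → H x → H (f x) → SetwiseStab H f
    SetwiseStab-class {f} {x} f∈ hx hfx = maps-into , maps-onto
      where
      maps-into : ∀ z → H z → H (f z)
      maps-into z hz = H-closed hfx (E-inv f∈ (related hx hz))

      maps-onto : ∀ w → H w → Σ G λ z → H z × (f z ≡ w)
      maps-onto w hw with inv∈ f∈
      ... | g , g∈ , gf≡id , fg≡id =
        g w , H-closed hx (subst (λ u → E u (g w)) (gf≡id x) (E-inv g∈ (related hfx hw))) , fg≡id w

    ω-restrict : ∀ {x y} → H x → H y → ω Υ x y → ω (Restrict Υ H) x y
    ω-restrict hx hy (f , f∈ , refl) = f , (f∈ , SetwiseStab-class f∈ hx hy) , refl

  Finitises-restrict : {_⇒_ α : G → G → Set} {Ω : (G → G) → Set} {H : G → Set} →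
    IsAutGroup _⇒_ Ω → Finitises Univ _⇒_ Ω α → Stable α H →
    (∀ {x y} → H x → H y → ω Ω x y → ω (Restrict Ω H) x y) →
    Finitises H _⇒_ (Restrict Ω H) (α ∩² H)
  Finitises-restrict {_⇒_} {α} {Ω} {H} grp fin stable ω-restrict = record
    { α-refl  = α∩H-refl
    ; α-sym   = λ hx hy (xy , _) → F.α-sym tt tt xy , hy , hx
    ; α-trans = λ hx hy hz (xy , _) (yz , _) → F.α-trans tt tt tt xy yz , hx , hz
    ; α⊆ω     = λ hx hy (xy , _) → ω-restrict hx hy (F.α⊆ω tt tt xy)
    ; A1      = λ (f∈ , f[H]≡H) hx hy (xy , _) →
        F.A1 f∈ tt tt xy , proj₁ f[H]≡H _ hx , proj₁ f[H]≡H _ hy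
    ; A2-total = λ {o} {p} _ hp o⇒p → λ { ha (f , (f∈ , f[H]≡H) , refl) →
        let hfp = proj₁ f[H]≡H p hp in
        f p , hfp , (f , (f∈ , f[H]≡H) , refl) , image-edge f∈ ha hfp o⇒p }
    ; A2-onto  = λ {o} {p} ho _ o⇒p → λ { hb (f , (f∈ , f[H]≡H) , refl) →
        let hfo = proj₁ f[H]≡H o ho in
        f o , hfo , (f , (f∈ , f[H]≡H) , refl) , image-edge f∈ hfo hb o⇒p }
    ; A2-func = λ _ _ o⇒p _ hb hb′ oa pb pb′ ab ab′ →
        F.A2-func tt tt o⇒p tt tt tt (ω⊆ oa) (ω⊆ pb) (ω⊆ pb′)
          (ClassArrow⊆ ab) (ClassArrow⊆ ab′) , hb , hb′
    ; A2-inj  = λ _ _ o⇒p ha ha′ _ oa oa′ pb ab a′b →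
        F.A2-inj tt tt o⇒p tt tt tt (ω⊆ oa) (ω⊆ oa′) (ω⊆ pb)
          (ClassArrow⊆ ab) (ClassArrow⊆ a′b) , ha , ha′
    ; A3 = λ {x} _ → let (n , reps , classify) = F.A3 {x} tt in
        n , reps , λ hy xy → let (i , y~rep) = classify tt (Conn-mono _ xy) in
          i , y~rep , hy , stable hy y~rep
    }
    where
    module F = Finitises fin
    open IsAutGroup grp using (auto)

    α∩H-refl : ∀ {x} → H x → (α ∩² H) x x
    α∩H-refl hx = F.α-refl tt , hx , hx

    ω⊆ : ∀ {x y} → ω (Restrict Ω H) x y → ω Ω x y
    ω⊆ = ω-mono proj₁

    ClassArrow⊆ : ∀ {a b} → ClassArrow H _⇒_ (α ∩² H) a b → ClassArrow Univ _⇒_ α a b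
    ClassArrow⊆ = ClassArrow-mono {α = α ∩² H} {β = α} _ proj₁

    image-edge : ∀ {f o p} → Ω f → H (f o) → H (f p) → o ⇒ p →
      ClassArrow H _⇒_ (α ∩² H) (f o) (f p)
    image-edge {f} {o} {p} f∈ hfo hfp o⇒p =
      ClassArrow-edge {α = α ∩² H} α∩H-refl hfo hfp (Equivalence.to (auto f∈ o p) o⇒p)

lemma8 : {G : Set} (_⇒_ : G → G → Set) (Ω : (G → G) → Set)
    (α : G → G → Set) (H : G → Set) →
    IsAutGroup _⇒_ Ω → Oligomorphic Ω →
    Finitises Univ _⇒_ Ω α →
    Stable α H → Reductionistic Ω H →
    Finitises H _⇒_ (Restrict Ω H) (α ∩² H)
lemma8 _⇒_ Ω α H grp _ fin stable (_ , E , _ , E-sym , E-trans , E-inv , c , H⇔E) =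
  Finitises-restrict grp fin stable ω-restrict
  where open InvariantClass grp E-sym E-trans E-inv H⇔E
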